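{- If $k\ge 3$ is an integer, then $\chi_{NL}(C_{\ell(k)-1})\ge k+1$, where $\ell(k)=\frac{k^3-k^2}{2}$ and $C_m$ is the cycle of order $m$.
   Context: A $k$-coloring of a graph $G$ is a partition of $V(G)$ into $k$ independent sets (colors). A coloring $\{S_1,\dots,S_k\}$ is neighbor-locating (an NL-coloring) if for any two distinct vertices $u,v$ in the same color class, $\{j: N(u)\cap S_j\neq\emptyset\}\neq\{j: N(v)\cap S_j\neq\emptyset\}$. The neighbor-locating chromatic number $\chi_{NL}(G)$ is the minimum number of colors in an NL-coloring of $G$. -}

module Defs where

open import Data.Nat using (ℕ; suc; _∸_; _^_)
open import Data.Nat.DivMod using (_/_)
open import Data.Fin using (Fin; toℕ)
open import Data.Product using (Σ; ∃; _×_)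
open import Data.Sum using (_⊎_)
open import Relation.Binary.PropositionalEquality using (_≡_)
open import Relation.Nullary using (¬_)
open import Function.Bundles using (_⇔_)

Graph : ℕ → Set₁
Graph n = Fin n → Fin n → Set

-- The cycle C_m on vertices 0,…,m-1 : i ~ j iff they are consecutive,
-- or {i , j} = {0 , m-1}.  (For m ≥ 3 this is the cycle of order m.)
Cycle : (m : ℕ) → Graph m
Cycle m i j =
  (toℕ j ≡ suc (toℕ i)) ⊎ (toℕ i ≡ suc (toℕ j))
  ⊎ ((toℕ i ≡ 0) × (toℕ j ≡ m ∸ 1)) ⊎ ((toℕ j ≡ 0) × (toℕ i ≡ m ∸ 1))

-- A k-coloring: a map into Fin k whose colour classes are independent sets,
-- and all k classes are non-empty (a partition of V(G) into k independent sets).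
record IsColoring {n : ℕ} (G : Graph n) (k : ℕ) (c : Fin n → Fin k) : Set where
  field
    proper     : ∀ u v → G u v → ¬ (c u ≡ c v)
    surjective : ∀ (i : Fin k) → ∃ λ v → c v ≡ i

NbrColor : {n k : ℕ} (G : Graph n) (c : Fin n → Fin k) → Fin n → Fin k → Set
NbrColor G c u j = ∃ λ w → G u w × (c w ≡ j)

record IsNLColoring {n : ℕ} (G : Graph n) (k : ℕ) (c : Fin n → Fin k) : Set where
  field
    coloring : IsColoring G k c
    locating : ∀ u v → ¬ (u ≡ v) → c u ≡ c v →
               ¬ (∀ (j : Fin k) → (NbrColor G c u j ⇔ NbrColor G c v j))

ℓ : ℕ → ℕ
ℓ k = (k ^ 3 ∸ k ^ 2) / 2

-- Let c be a neighbour-locating colouring of the cycle C_n with j colours and let D(a,b)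
-- be the number of pairs (vertex of colour a, neighbour of colour b).  D is symmetric with
-- zero diagonal, and row a sums to twice the size of colour class a, so D has total 2n.
-- The locating property bounds every entry by j: labelling each (a,b)-incidence by the
-- colour on the other side of its vertex (swapping a and b on forward incidences) is
-- injective, and a pigeonhole principle for partial injections applies.  Hence
-- 2n ≤ j³ - j², and because every row sum and the row maximum j(j-1) are even, a parity
-- argument shows that the total cannot fall short of j³ - j² by exactly 2.
-- As 2(ℓ(k) - 1) = k³ - k² - 2, a palette of k colours is excluded by the parity
-- argument and a palette of fewer than k colours by the size bound.
module Submission where

open import Defs
open import Data.Nat using (ℕ; zero; suc; _+_; _*_; _∸_; _^_; _≤_; _<_; pred; z≤n; s≤s; _≤?_)
open import Data.Nat.Properties renaming (_≟_ to _≟ℕ_)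
open import Data.Nat.DivMod using (_/_; m*n/n≡m)
open import Data.Nat.Tactic.RingSolver using (solve-∀)
open import Data.Fin using (Fin; zero; suc; toℕ; fromℕ; inject₁; lower₁; punchIn; punchOut; splitAt; join; _↑ˡ_; _↑ʳ_; _≟_)
import Data.Fin.Properties as Finₚ
open import Data.Fin.Permutation.Components using (transpose; transpose-inverse)
open import Data.Maybe using (Maybe; just; nothing)
open import Data.Maybe.Properties using (just-injective)
open import Data.Product using (∃; _,_; _×_; proj₁; proj₂; map₂)
open import Data.Sum using (_⊎_; inj₁; inj₂; [_,_])
import Data.Sum as Sum
open import Data.Empty using (⊥; ⊥-elim)
open import Function using (_∘_)
open import Function.Bundles using (_⇔_; mk⇔; Equivalence)
open import Relation.Binary.PropositionalEquality using (_≡_; _≢_; refl; sym; trans; cong; cong₂; subst; subst₂)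
open import Relation.Nullary using (¬_; Dec; yes; no; contradiction)
open import Algebra.Properties.Semiring.Sum +-*-semiring
  using (sum; sum-cong-≗; sum-replicate-zero; sum-init-last; ∑-distrib-+; ∑-comm; *-distribˡ-sum)
open import Algebra.Properties.CommutativeSemigroup +-commutativeSemigroup using (xy∙z≈xz∙y; interchange)

open ≤-Reasoning

sum-mono : ∀ {n} {f g : Fin n → ℕ} → (∀ i → f i ≤ g i) → sum f ≤ sum g
sum-mono {zero}  f≤g = z≤n
sum-mono {suc n} f≤g = +-mono-≤ (f≤g zero) (sum-mono (f≤g ∘ suc))

sum-const : ∀ n k → sum {n} (λ _ → k) ≡ n * k
sum-const zero    k = refl
sum-const (suc n) k = cong (k +_) (sum-const n k)

sum-split : ∀ n n' (f : Fin (n + n') → ℕ) →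
  sum f ≡ sum (λ i → f (i ↑ˡ n')) + sum (λ i → f (n ↑ʳ i))
sum-split zero    n' f = refl
sum-split (suc n) n' f =
  trans (cong (f zero +_) (sum-split n n' (f ∘ suc))) (sym (+-assoc (f zero) _ _))

sum-<⇒∃< : ∀ {n} (f g : Fin n → ℕ) → sum f < sum g → ∃ λ i → f i < g i
sum-<⇒∃< {n} f g lt = map₂ ≰⇒> (Finₚ.¬∀⟶∃¬ n (λ i → g i ≤ f i) (λ i → g i ≤? f i)
  (λ g≤f → <⇒≱ lt (sum-mono g≤f)))

sum-gap : ∀ {n} {f g : Fin n → ℕ} (a : Fin n) {d : ℕ} →
  (∀ i → f i ≤ g i) → f a + d ≤ g a → sum f + d ≤ sum g
sum-gap {suc n} {f} {g} zero {d} f≤g room = begin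
  f zero + sum (f ∘ suc) + d   ≡⟨ xy∙z≈xz∙y (f zero) _ d ⟩
  f zero + d + sum (f ∘ suc)   ≤⟨ +-mono-≤ room (sum-mono (f≤g ∘ suc)) ⟩
  g zero + sum (g ∘ suc)       ∎
sum-gap {suc n} {f} {g} (suc a) {d} f≤g room = begin
  f zero + sum (f ∘ suc) + d   ≡⟨ +-assoc (f zero) _ d ⟩
  f zero + (sum (f ∘ suc) + d) ≤⟨ +-mono-≤ (f≤g zero) (sum-gap a (f≤g ∘ suc) room) ⟩
  g zero + sum (g ∘ suc)       ∎

sum-gap₂ : ∀ {n} {f g : Fin n → ℕ} {a b : Fin n} {d e : ℕ} → a ≢ b →
  (∀ i → f i ≤ g i) → f a + d ≤ g a → f b + e ≤ g b → sum f + (d + e) ≤ sum g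
sum-gap₂ {a = zero} {zero} a≢b _ _ _ = contradiction refl a≢b
sum-gap₂ {suc n} {f} {g} {zero} {suc b} {d} {e} _ f≤g room-a room-b = begin
  f zero + sum (f ∘ suc) + (d + e)     ≡⟨ interchange (f zero) _ d e ⟩
  (f zero + d) + (sum (f ∘ suc) + e)   ≤⟨ +-mono-≤ room-a (sum-gap b (f≤g ∘ suc) room-b) ⟩
  g zero + sum (g ∘ suc)               ∎
sum-gap₂ {suc n} {f} {g} {suc a} {zero} {d} {e} _ f≤g room-a room-b = begin
  f zero + sum (f ∘ suc) + (d + e)     ≡⟨ cong (f zero + sum (f ∘ suc) +_) (+-comm d e) ⟩
  f zero + sum (f ∘ suc) + (e + d)     ≡⟨ interchange (f zero) _ e d ⟩
  (f zero + e) + (sum (f ∘ suc) + d)   ≤⟨ +-mono-≤ room-b (sum-gap a (f≤g ∘ suc) room-a) ⟩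
  g zero + sum (g ∘ suc)               ∎
sum-gap₂ {suc n} {f} {g} {suc a} {suc b} {d} {e} a≢b f≤g room-a room-b = begin
  f zero + sum (f ∘ suc) + (d + e)     ≡⟨ +-assoc (f zero) _ (d + e) ⟩
  f zero + (sum (f ∘ suc) + (d + e))   ≤⟨ +-mono-≤ (f≤g zero) (sum-gap₂ (a≢b ∘ cong suc) (f≤g ∘ suc) room-a room-b) ⟩
  g zero + sum (g ∘ suc)               ∎

δ : ∀ {n} → Fin n → Fin n → ℕ
δ zero    zero    = 1
δ zero    (suc _) = 0
δ (suc _) zero    = 0
δ (suc a) (suc b) = δ a b

δ-≡ : ∀ {n} {a b : Fin n} → a ≡ b → δ a b ≡ 1
δ-≡ {a = zero}  refl = refl
δ-≡ {a = suc a} refl = δ-≡ {a = a} refl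

δ-≢ : ∀ {n} {a b : Fin n} → a ≢ b → δ a b ≡ 0
δ-≢ {a = zero}  {zero}  a≢b = contradiction refl a≢b
δ-≢ {a = zero}  {suc b} _   = refl
δ-≢ {a = suc a} {zero}  _   = refl
δ-≢ {a = suc a} {suc b} a≢b = δ-≢ (a≢b ∘ cong suc)

sum-δ : ∀ {n} (a : Fin n) → sum (δ a) ≡ 1
sum-δ {suc n} zero    = cong suc (sum-replicate-zero n)
sum-δ         (suc a) = sum-δ a

δ-disjoint : ∀ {n} {x y : Fin n} (a : Fin n) → x ≢ y → δ x a * δ y a ≡ 0
δ-disjoint {x = x} {y} a x≢y with x ≟ a
... | yes refl = trans (cong (δ x x *_) (δ-≢ (x≢y ∘ sym))) (*-zeroʳ (δ x x))
... | no  x≢a  = cong (_* δ y a) (δ-≢ x≢a)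

-- 1 where a partial value is defined, 0 elsewhere; Σ defined ∘ g is the size of dom g.
defined : ∀ {A : Set} → Maybe A → ℕ
defined nothing  = 0
defined (just _) = 1

PartialInjective : ∀ {A B : Set} → (A → Maybe B) → Set
PartialInjective g = ∀ {p q y} → g p ≡ just y → g q ≡ just y → p ≡ q

delete : ∀ {j} → Fin (suc j) → Maybe (Fin (suc j)) → Maybe (Fin j)
delete y nothing  = nothing
delete y (just z) with y ≟ z
... | yes _   = nothing
... | no y≢z  = just (punchOut y≢z)

delete-defined : ∀ {j} (y : Fin (suc j)) (m : Maybe (Fin (suc j))) → m ≢ just y →
  defined (delete y m) ≡ defined m
delete-defined y nothing  _ = refl
delete-defined y (just z) m≢y with y ≟ z
... | yes y≡z = contradiction (cong just (sym y≡z)) m≢y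
... | no  _   = refl

delete-just : ∀ {j} (y : Fin (suc j)) {m w} → delete y m ≡ just w → m ≡ just (punchIn y w)
delete-just y {just z} e with y ≟ z
delete-just y {just z} () | yes _
... | no y≢z = cong just (trans (sym (Finₚ.punchIn-punchOut y≢z)) (cong (punchIn y) (just-injective e)))

pigeonhole : ∀ {N j} (g : Fin N → Maybe (Fin j)) → PartialInjective g → sum (defined ∘ g) ≤ j
pigeonhole {zero}  g inj = z≤n
pigeonhole {suc N} g inj with g zero in g0
... | nothing = pigeonhole (g ∘ suc) (λ e e' → Finₚ.suc-injective (inj e e'))
pigeonhole {suc N} {zero}  g inj | just ()
pigeonhole {suc N} {suc j} g inj | just y = s≤s (begin
  sum (defined ∘ g ∘ suc)   ≡⟨ sum-cong-≗ (λ p → sym (delete-defined y (g (suc p)) (avoids p))) ⟩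
  sum (defined ∘ g′)        ≤⟨ pigeonhole g′ inj′ ⟩
  j                         ∎)
  where
  avoids : ∀ p → g (suc p) ≢ just y
  avoids p e = Finₚ.0≢1+n (inj g0 e)
  g′ : Fin N → Maybe (Fin j)
  g′ = delete y ∘ g ∘ suc
  inj′ : PartialInjective g′
  inj′ e e' = Finₚ.suc-injective (inj (delete-just y e) (delete-just y e'))

pigeonhole-⊎ : ∀ {N j} (g : Fin N ⊎ Fin N → Maybe (Fin j)) → PartialInjective g →
  sum (defined ∘ g ∘ inj₁) + sum (defined ∘ g ∘ inj₂) ≤ j
pigeonhole-⊎ {N} {j} g inj = begin
  sum (defined ∘ g ∘ inj₁) + sum (defined ∘ g ∘ inj₂)
    ≡⟨ cong₂ _+_ (sum-cong-≗ (λ i → cong (defined ∘ g) (sym (Finₚ.splitAt-↑ˡ N i N))))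
                 (sum-cong-≗ (λ i → cong (defined ∘ g) (sym (Finₚ.splitAt-↑ʳ N N i)))) ⟩
  sum (λ i → defined (g (splitAt N (i ↑ˡ N)))) + sum (λ i → defined (g (splitAt N (N ↑ʳ i))))
    ≡⟨ sum-split N N (defined ∘ g ∘ splitAt N) ⟨
  sum (defined ∘ g ∘ splitAt N)
    ≤⟨ pigeonhole (g ∘ splitAt N) (λ e e' → splitAt-injective (inj e e')) ⟩
  j ∎
  where
  splitAt-injective : ∀ {p q} → splitAt N p ≡ splitAt N q → p ≡ q
  splitAt-injective {p} {q} eq =
    trans (sym (Finₚ.join-splitAt N N p)) (trans (cong (join N N) eq) (Finₚ.join-splitAt N N q))

next : ∀ {m} → Fin (suc m) → Fin (suc m)
next {m} i with m ≟ℕ toℕ i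
... | yes _   = zero
... | no  m≢i = suc (lower₁ i m≢i)

prev : ∀ {m} → Fin (suc m) → Fin (suc m)
prev {m}     zero    = fromℕ m
prev {suc m} (suc i) = inject₁ i

next-cases : ∀ {m} (i : Fin (suc m)) →
  (toℕ i ≡ m × next i ≡ zero) ⊎ (toℕ i ≢ m × toℕ (next i) ≡ suc (toℕ i))
next-cases {m} i with m ≟ℕ toℕ i
... | yes m≡i = inj₁ (sym m≡i , refl)
... | no  m≢i = inj₂ (m≢i ∘ sym , cong suc (Finₚ.toℕ-lower₁ i m≢i))

prev-cases : ∀ {m} (i : Fin (suc m)) →
  (i ≡ zero × toℕ (prev i) ≡ m) ⊎ (toℕ i ≡ suc (toℕ (prev i)))
prev-cases {m}     zero    = inj₁ (refl , Finₚ.toℕ-fromℕ m)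
prev-cases {suc m} (suc i) = inj₂ (cong suc (sym (Finₚ.toℕ-inject₁ i)))

prev-next : ∀ {m} (i : Fin (suc m)) → prev (next i) ≡ i
prev-next {m} i with next-cases i
... | inj₁ (i≡m , next≡0) rewrite next≡0 =
  Finₚ.toℕ-injective (trans (Finₚ.toℕ-fromℕ m) (sym i≡m))
... | inj₂ (_ , next≡1+i) with prev-cases (next i)
...   | inj₁ (next≡0 , _) = contradiction (trans (sym next≡1+i) (cong toℕ next≡0)) λ ()
...   | inj₂ next≡1+prev  = Finₚ.toℕ-injective (suc-injective (trans (sym next≡1+prev) next≡1+i))

next-inject₁ : ∀ {m} (i : Fin m) → next (inject₁ i) ≡ suc i
next-inject₁ i with next-cases (inject₁ i)
... | inj₁ (i≡m , _) = contradiction (trans (sym (Finₚ.toℕ-inject₁ i)) i≡m) (<⇒≢ (Finₚ.toℕ<n i))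
... | inj₂ (_ , e)   = Finₚ.toℕ-injective (trans e (cong suc (Finₚ.toℕ-inject₁ i)))

next-fromℕ : ∀ m → next (fromℕ m) ≡ zero
next-fromℕ m with next-cases (fromℕ m)
... | inj₁ (_ , e)   = e
... | inj₂ (≢m , _)  = contradiction (Finₚ.toℕ-fromℕ m) ≢m

sum-rotate : ∀ {m} (f : Fin (suc m) → ℕ) → sum (f ∘ next) ≡ sum f
sum-rotate {m} f = begin-equality
  sum (f ∘ next)                         ≡⟨ sum-init-last (f ∘ next) ⟩
  sum (f ∘ next ∘ inject₁) + f (next (fromℕ m))
    ≡⟨ cong₂ _+_ (sum-cong-≗ (cong f ∘ next-inject₁)) (cong f (next-fromℕ m)) ⟩
  sum (f ∘ suc) + f zero                 ≡⟨ +-comm _ (f zero) ⟩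
  sum f                                  ∎

neighbour-cases : ∀ {m} (u w : Fin (suc m)) → Cycle (suc m) u w → w ≡ next u ⊎ w ≡ prev u
neighbour-cases u w (inj₁ w≡1+u) with next-cases u
... | inj₁ (u≡m , _) = contradiction (trans w≡1+u (cong suc u≡m)) (<⇒≢ (Finₚ.toℕ<n w))
... | inj₂ (_ , e)   = inj₁ (Finₚ.toℕ-injective (trans w≡1+u (sym e)))
neighbour-cases u w (inj₂ (inj₁ u≡1+w)) with prev-cases u
... | inj₁ (refl , _) = contradiction u≡1+w λ ()
... | inj₂ e          = inj₂ (Finₚ.toℕ-injective (suc-injective (trans (sym u≡1+w) e)))
neighbour-cases u w (inj₂ (inj₂ (inj₁ (u≡0 , w≡m)))) with prev-cases u
... | inj₁ (_ , e) = inj₂ (Finₚ.toℕ-injective (trans w≡m (sym e)))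
... | inj₂ e       = contradiction (trans (sym u≡0) e) λ ()
neighbour-cases u w (inj₂ (inj₂ (inj₂ (w≡0 , u≡m)))) with next-cases u
... | inj₁ (_ , e)   = inj₁ (trans (Finₚ.toℕ-injective w≡0) (sym e))
... | inj₂ (u≢m , _) = contradiction u≡m u≢m

next-adjacent : ∀ {m} (u : Fin (suc m)) → Cycle (suc m) u (next u)
next-adjacent u with next-cases u
... | inj₁ (u≡m , e) = inj₂ (inj₂ (inj₂ (cong toℕ e , u≡m)))
... | inj₂ (_ , e)   = inj₁ e

prev-adjacent : ∀ {m} (u : Fin (suc m)) → Cycle (suc m) u (prev u)
prev-adjacent u with prev-cases u
... | inj₁ (u≡0 , e) = inj₂ (inj₂ (inj₁ (cong toℕ u≡0 , e)))
... | inj₂ e         = inj₂ (inj₁ e)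

Sees : ∀ {m j} → (Fin (suc m) → Fin j) → Fin (suc m) → Fin j → Set
Sees c i z = c (next i) ≡ z ⊎ c (prev i) ≡ z

record LocatingCycleColouring {m j : ℕ} (c : Fin (suc m) → Fin j) : Set where
  field
    proper-next : ∀ i → c i ≢ c (next i)
    proper-prev : ∀ i → c i ≢ c (prev i)
    locating    : ∀ u v → c u ≡ c v → (∀ z → Sees c u z ⇔ Sees c v z) → u ≡ v

neighbour-colour⇔sees : ∀ {m j} (c : Fin (suc m) → Fin j) u z →
  NbrColor (Cycle (suc m)) c u z ⇔ Sees c u z
neighbour-colour⇔sees c u z = mk⇔ to from
  where
  to : NbrColor (Cycle _) c u z → Sees c u z
  to (w , u~w , cw≡z) with neighbour-cases u w u~w
  ... | inj₁ refl = inj₁ cw≡z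
  ... | inj₂ refl = inj₂ cw≡z
  from : Sees c u z → NbrColor (Cycle _) c u z
  from (inj₁ e) = next u , next-adjacent u , e
  from (inj₂ e) = prev u , prev-adjacent u , e

nl⇒locating : ∀ {m j} {c : Fin (suc m) → Fin j} →
  IsNLColoring (Cycle (suc m)) j c → LocatingCycleColouring c
nl⇒locating {c = c} nl = record
  { proper-next = λ i → proper i (next i) (next-adjacent i)
  ; proper-prev = λ i → proper i (prev i) (prev-adjacent i)
  ; locating    = locating′
  }
  where
  open IsNLColoring nl
  open IsColoring coloring
  open Equivalence
  locating′ : ∀ u v → c u ≡ c v → (∀ z → Sees c u z ⇔ Sees c v z) → u ≡ v
  locating′ u v cu≡cv same with u ≟ v
  ... | yes u≡v = u≡v
  ... | no  u≢v = contradiction (λ z → mk⇔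
          (from (neighbour-colour⇔sees c v z) ∘ to (same z) ∘ to (neighbour-colour⇔sees c u z))
          (from (neighbour-colour⇔sees c u z) ∘ from (same z) ∘ to (neighbour-colour⇔sees c v z)))
        (locating u v u≢v cu≡cv)

module Incidence {m j : ℕ} (c : Fin (suc m) → Fin j) where

  count : Fin j → ℕ
  count a = sum (λ i → δ (c i) a)

  Arc : (Fin (suc m) → Fin (suc m)) → Fin j → Fin j → Fin (suc m) → Set
  Arc nb a b i = c i ≡ a × c (nb i) ≡ b

  arcs : (Fin (suc m) → Fin (suc m)) → Fin j → Fin j → ℕ
  arcs nb a b = sum (λ i → δ (c i) a * δ (c (nb i)) b)

  D : Fin j → Fin j → ℕ
  D a b = arcs next a b + arcs prev a b

  count-total : sum count ≡ suc m
  count-total = begin-equality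
    sum (λ a → sum (λ i → δ (c i) a)) ≡⟨ ∑-comm (λ a i → δ (c i) a) ⟩
    sum (λ i → sum (δ (c i)))         ≡⟨ sum-cong-≗ (sum-δ ∘ c) ⟩
    sum {suc m} (λ _ → 1)             ≡⟨ sum-const (suc m) 1 ⟩
    suc m * 1                         ≡⟨ *-identityʳ (suc m) ⟩
    suc m                             ∎

  -- Every vertex of colour a starts exactly one arc along nb.
  arcs-row : ∀ nb a → sum (arcs nb a) ≡ count a
  arcs-row nb a = begin-equality
    sum (λ b → sum (λ i → δ (c i) a * δ (c (nb i)) b)) ≡⟨ ∑-comm (λ b i → δ (c i) a * δ (c (nb i)) b) ⟩
    sum (λ i → sum (λ b → δ (c i) a * δ (c (nb i)) b)) ≡⟨ sum-cong-≗ (λ i → *-distribˡ-sum (δ (c i) a) (δ (c (nb i)))) ⟨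
    sum (λ i → δ (c i) a * sum (δ (c (nb i))))          ≡⟨ sum-cong-≗ (λ i → cong (δ (c i) a *_) (sum-δ (c (nb i)))) ⟩
    sum (λ i → δ (c i) a * 1)                           ≡⟨ sum-cong-≗ (λ i → *-identityʳ (δ (c i) a)) ⟩
    count a                                             ∎

  D-row : ∀ a → sum (D a) ≡ count a + count a
  D-row a = trans (∑-distrib-+ (arcs next a) (arcs prev a)) (cong₂ _+_ (arcs-row next a) (arcs-row prev a))

  -- Reversing an arc: rotating by next turns (a,b)-arcs along prev into (b,a)-arcs along next.
  arcs-prev : ∀ a b → arcs prev a b ≡ arcs next b a
  arcs-prev a b = begin-equality
    sum (λ i → δ (c i) a * δ (c (prev i)) b)               ≡⟨ sum-rotate (λ i → δ (c i) a * δ (c (prev i)) b) ⟨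
    sum (λ i → δ (c (next i)) a * δ (c (prev (next i))) b) ≡⟨ sum-cong-≗ swap-factors ⟩
    sum (λ i → δ (c i) b * δ (c (next i)) a)               ∎
    where
    swap-factors : ∀ i → δ (c (next i)) a * δ (c (prev (next i))) b ≡ δ (c i) b * δ (c (next i)) a
    swap-factors i = trans (cong (λ v → δ (c (next i)) a * δ (c v) b) (prev-next i))
                           (*-comm (δ (c (next i)) a) (δ (c i) b))

  D-sym : ∀ a b → D a b ≡ D b a
  D-sym a b = begin-equality
    arcs next a b + arcs prev a b ≡⟨ cong₂ _+_ (sym (arcs-prev b a)) (arcs-prev a b) ⟩
    arcs prev b a + arcs next b a ≡⟨ +-comm (arcs prev b a) (arcs next b a) ⟩
    arcs next b a + arcs prev b a ∎

  arcs-diag : ∀ nb → (∀ i → c i ≢ c (nb i)) → ∀ a → arcs nb a a ≡ 0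
  arcs-diag nb proper a =
    trans (sum-cong-≗ (λ i → δ-disjoint a (proper i))) (sum-replicate-zero (suc m))

  arcLabel : (Fin (suc m) → Fin (suc m)) → (Fin (suc m) → Fin j) → Fin j → Fin j →
             Fin (suc m) → Maybe (Fin j)
  arcLabel nb label a b i with c i ≟ a | c (nb i) ≟ b
  ... | yes _ | yes _ = just (label i)
  ... | yes _ | no  _ = nothing
  ... | no  _ | _     = nothing

  arcLabel-defined : ∀ nb label a b i → defined (arcLabel nb label a b i) ≡ δ (c i) a * δ (c (nb i)) b
  arcLabel-defined nb label a b i with c i ≟ a | c (nb i) ≟ b
  ... | yes e | yes e' = sym (cong₂ _*_ (δ-≡ e) (δ-≡ e'))
  ... | yes _ | no  ne = sym (trans (cong (δ (c i) a *_) (δ-≢ ne)) (*-zeroʳ (δ (c i) a)))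
  ... | no ne | _      = sym (cong (_* δ (c (nb i)) b) (δ-≢ ne))

  arcLabel-just : ∀ nb label a b i {y} → arcLabel nb label a b i ≡ just y →
    Arc nb a b i × label i ≡ y
  arcLabel-just nb label a b i e with c i ≟ a | c (nb i) ≟ b
  arcLabel-just nb label a b i refl | yes e₁ | yes e₂ = (e₁ , e₂) , refl
  arcLabel-just nb label a b i ()   | yes _  | no _
  arcLabel-just nb label a b i ()   | no _   | _

transpose-injective : ∀ {n} (i j : Fin n) {x y} → transpose i j x ≡ transpose i j y → x ≡ y
transpose-injective i j {x} {y} e =
  trans (sym (transpose-inverse j i)) (trans (cong (transpose j i) e) (transpose-inverse j i))

transpose-matchˡ : ∀ {n} (i j : Fin n) → transpose i j i ≡ j
transpose-matchˡ i j with i ≟ i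
... | yes _  = refl
... | no i≢i = contradiction refl i≢i

transpose-fixed : ∀ {n} {i j k : Fin n} → k ≢ i → k ≢ j → transpose i j k ≡ k
transpose-fixed {i = i} {j} {k} k≢i k≢j with k ≟ i
... | yes k≡i = contradiction k≡i k≢i
... | no _ with k ≟ j
...   | yes k≡j = contradiction k≡j k≢j
...   | no _    = refl

module ArcBound {m j : ℕ} {c : Fin (suc m) → Fin j} (L : LocatingCycleColouring c) where
  open LocatingCycleColouring L
  open Incidence c

  same-view : ∀ {u v} → c u ≡ c v → c (next u) ≡ c (next v) → c (prev u) ≡ c (prev v) → u ≡ v
  same-view {u} {v} cu≡cv n≡n p≡p = locating u v cu≡cv λ z →
    mk⇔ (Sum.map (trans (sym n≡n)) (trans (sym p≡p))) (Sum.map (trans n≡n) (trans p≡p))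

  crossed-view : ∀ {u v} → c u ≡ c v → c (next u) ≡ c (prev v) → c (prev u) ≡ c (next v) → u ≡ v
  crossed-view {u} {v} cu≡cv n≡p p≡n = locating u v cu≡cv λ z →
    mk⇔ (Sum.swap ∘ Sum.map (trans (sym n≡p)) (trans (sym p≡n)))
        (Sum.swap ∘ Sum.map (trans p≡n) (trans n≡p))

  D-diag : ∀ a → D a a ≡ 0
  D-diag a = cong₂ _+_ (arcs-diag next proper-next a) (arcs-diag prev proper-prev a)

  -- The
  -- swap separates the two arcs of an a-vertex whose neighbours are both coloured b.
  module _ (a b : Fin j) where

    forward-label : Fin (suc m) → Fin j
    forward-label i = transpose b a (c (prev i))

    backward-label : Fin (suc m) → Fin j
    backward-label i = c (next i)

    labelling : Fin (suc m) ⊎ Fin (suc m) → Maybe (Fin j)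
    labelling = [ arcLabel next forward-label a b , arcLabel prev backward-label a b ]

    forward-forward : ∀ {i i' y} →
      Arc next a b i × forward-label i ≡ y → Arc next a b i' × forward-label i' ≡ y → i ≡ i'
    forward-forward ((ci , ni) , li) ((ci' , ni') , li') =
      same-view (trans ci (sym ci')) (trans ni (sym ni')) (transpose-injective b a (trans li (sym li')))

    backward-backward : ∀ {i i' y} →
      Arc prev a b i × backward-label i ≡ y → Arc prev a b i' × backward-label i' ≡ y → i ≡ i'
    backward-backward ((ci , pi) , li) ((ci' , pi') , li') =
      same-view (trans ci (sym ci')) (trans li (sym li')) (trans pi (sym pi'))

    -- Arcs along opposite directions never share a label: if the vertex behind i has colour b
    -- the label is a, which properness forbids in front of the a-vertex i'; otherwise i and
    -- i' see the same colours in opposite orientations, so i = i' and behind i lies colour b.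
    forward-backward : ∀ {i i' y} →
      Arc next a b i × forward-label i ≡ y → Arc prev a b i' × backward-label i' ≡ y → ⊥
    forward-backward {i} {i'} ((ci , ni) , li) ((ci' , pi') , li') = by-cases (c (prev i) ≟ b)
      where
      by-cases : Dec (c (prev i) ≡ b) → ⊥
      by-cases (yes pi≡b) = proper-next i' (trans ci' (sym (trans li' (trans (sym li) swapped))))
        where
        swapped : forward-label i ≡ a
        swapped = trans (cong (transpose b a) pi≡b) (transpose-matchˡ b a)
      by-cases (no pi≢b) = pi≢b (trans (cong (c ∘ prev) i≡i') pi')
        where
        fixed : forward-label i ≡ c (prev i)
        fixed = transpose-fixed pi≢b (λ pi≡a → proper-prev i (trans ci (sym pi≡a)))
        i≡i' : i ≡ i'
        i≡i' = crossed-view (trans ci (sym ci')) (trans ni (sym pi')) (trans (sym fixed) (trans li (sym li')))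

    labelling-injective : PartialInjective labelling
    labelling-injective {inj₁ i} {inj₁ i'} e e' =
      cong inj₁ (forward-forward (arcLabel-just next forward-label a b i e) (arcLabel-just next forward-label a b i' e'))
    labelling-injective {inj₂ i} {inj₂ i'} e e' =
      cong inj₂ (backward-backward (arcLabel-just prev backward-label a b i e) (arcLabel-just prev backward-label a b i' e'))
    labelling-injective {inj₁ i} {inj₂ i'} e e' =
      ⊥-elim (forward-backward (arcLabel-just next forward-label a b i e) (arcLabel-just prev backward-label a b i' e'))
    labelling-injective {inj₂ i} {inj₁ i'} e e' =
      ⊥-elim (forward-backward (arcLabel-just next forward-label a b i' e') (arcLabel-just prev backward-label a b i e))

    D-≤ : D a b ≤ j
    D-≤ = begin
      arcs next a b + arcs prev a b
        ≡⟨ cong₂ _+_ (sum-cong-≗ (arcLabel-defined next forward-label a b))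
                     (sum-cong-≗ (arcLabel-defined prev backward-label a b)) ⟨
      sum (defined ∘ labelling ∘ inj₁) + sum (defined ∘ labelling ∘ inj₂)
        ≤⟨ pigeonhole-⊎ labelling labelling-injective ⟩
      j ∎

pronic-even : ∀ x → ∃ λ h → x * suc x ≡ h + h
pronic-even zero    = 0 , refl
pronic-even (suc x) with pronic-even x
... | h , e = h + suc x , (begin-equality
  suc x * suc (suc x)         ≡⟨ expand x ⟩
  x * suc x + (suc x + suc x) ≡⟨ cong (_+ (suc x + suc x)) e ⟩
  (h + h) + (suc x + suc x)   ≡⟨ interchange h h (suc x) (suc x) ⟩
  (h + suc x) + (h + suc x)   ∎)
  where
  expand : ∀ x → suc x * suc (suc x) ≡ x * suc x + (suc x + suc x)
  expand = solve-∀

-- j² = j + 2h for some h: the maximal row sum j(j-1) of a colour matrix is even.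
square-parity : ∀ j → ∃ λ h → j * j ≡ j + (h + h)
square-parity zero    = 0 , refl
square-parity (suc x) = map₂ (cong (suc x +_)) (pronic-even x)

same-parity-gap : ∀ r {h h'} → r + (h + h) < r + (h' + h') → r + (h + h) + 2 ≤ r + (h' + h')
same-parity-gap r {h} {h'} lt = begin
  r + (h + h) + 2       ≡⟨ regroup r h ⟩
  r + (suc h + suc h)   ≤⟨ +-monoʳ-≤ r (+-mono-≤ h<h' h<h') ⟩
  r + (h' + h')         ∎
  where
  h<h' : h < h'
  h<h' = ≰⇒> (λ h'≤h → <⇒≱ lt (+-monoʳ-≤ r (+-mono-≤ h'≤h h'≤h)))
  regroup : ∀ r h → r + (h + h) + 2 ≡ r + (suc h + suc h)
  regroup = solve-∀

module ColourMatrix {j : ℕ} (D : Fin j → Fin j → ℕ)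
  (D-sym : ∀ a b → D a b ≡ D b a)
  (D-diag : ∀ a → D a a ≡ 0)
  (D-≤ : ∀ a b → D a b ≤ j)
  (rows-even : ∀ a → ∃ λ h → sum (D a) ≡ h + h)
  where

  total : ℕ
  total = sum (λ a → sum (D a))

  -- Filling the diagonal with j gives a matrix whose entries are all at most j.
  filled : Fin j → Fin j → ℕ
  filled a b = j * δ a b + D a b

  filled-diag : ∀ a → filled a a ≡ j
  filled-diag a = begin-equality
    j * δ a a + D a a  ≡⟨ cong₂ _+_ (cong (j *_) (δ-≡ {a = a} refl)) (D-diag a) ⟩
    j * 1 + 0          ≡⟨ +-identityʳ (j * 1) ⟩
    j * 1              ≡⟨ *-identityʳ j ⟩
    j                  ∎

  filled-off : ∀ {a b} → a ≢ b → filled a b ≡ D a b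
  filled-off {a} {b} a≢b = cong (_+ D a b) (trans (cong (j *_) (δ-≢ a≢b)) (*-zeroʳ j))

  filled-≤ : ∀ a b → filled a b ≤ j
  filled-≤ a b with a ≟ b
  ... | yes refl = ≤-reflexive (filled-diag a)
  ... | no  a≢b  = subst (_≤ j) (sym (filled-off a≢b)) (D-≤ a b)

  row : Fin j → ℕ
  row a = j + sum (D a)

  filled-row : ∀ a → sum (filled a) ≡ row a
  filled-row a = begin-equality
    sum (filled a)                          ≡⟨ ∑-distrib-+ (λ b → j * δ a b) (D a) ⟩
    sum (λ b → j * δ a b) + sum (D a)       ≡⟨ cong (_+ sum (D a)) (*-distribˡ-sum j (δ a)) ⟨
    j * sum (δ a) + sum (D a)               ≡⟨ cong (λ s → j * s + sum (D a)) (sum-δ a) ⟩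
    j * 1 + sum (D a)                       ≡⟨ cong (_+ sum (D a)) (*-identityʳ j) ⟩
    row a                                   ∎

  row-≤ : ∀ a → row a ≤ j * j
  row-≤ a = begin
    row a             ≡⟨ filled-row a ⟨
    sum (filled a)    ≤⟨ sum-mono (filled-≤ a) ⟩
    sum {j} (λ _ → j) ≡⟨ sum-const j j ⟩
    j * j             ∎

  rows-total : sum row ≡ j * j + total
  rows-total = trans (∑-distrib-+ (λ _ → j) (λ a → sum (D a))) (cong (_+ total) (sum-const j j))

  total-bound : j * j + total ≤ j * (j * j)
  total-bound = begin
    j * j + total           ≡⟨ rows-total ⟨
    sum row                 ≤⟨ sum-mono row-≤ ⟩
    sum {j} (λ _ → j * j)   ≡⟨ sum-const j (j * j) ⟩
    j * (j * j)             ∎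

  -- row a and j * j have the same parity, so a short row is short by at least 2.
  row-parity-gap : ∀ a → row a < j * j → row a + 2 ≤ j * j
  row-parity-gap a row<jj =
    subst₂ (λ x y → x + 2 ≤ y) (sym row≡) (sym jj≡) (same-parity-gap j {h} {h'} (subst₂ _<_ row≡ jj≡ row<jj))
    where
    h h' : ℕ
    h  = proj₁ (rows-even a)
    h' = proj₁ (square-parity j)
    row≡ : row a ≡ j + (h + h)
    row≡ = cong (j +_) (proj₂ (rows-even a))
    jj≡ : j * j ≡ j + (h' + h')
    jj≡ = proj₂ (square-parity j)

  short-entry : ∀ a → row a < j * j → ∃ λ b → a ≢ b × D a b < j
  short-entry a row<jj = off-diagonal (sum-<⇒∃< (filled a) (λ _ → j) filled-short)
    where
    filled-short : sum (filled a) < sum {j} (λ _ → j)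
    filled-short = subst₂ _<_ (sym (filled-row a)) (sym (sum-const j j)) row<jj
    off-diagonal : (∃ λ b → filled a b < j) → ∃ λ b → a ≢ b × D a b < j
    off-diagonal (b , Fab<j) = b , a≢b , subst (_< j) (filled-off a≢b) Fab<j
      where
      a≢b : a ≢ b
      a≢b refl = <-irrefl (filled-diag a) Fab<j

  -- By symmetry the entry D b a is short as well, so row b is short too.
  partner-row : ∀ {a b} → a ≢ b → D a b < j → row b + 1 ≤ j * j
  partner-row {a} {b} a≢b Dab<j = begin
    row b + 1           ≡⟨ cong (_+ 1) (filled-row b) ⟨
    sum (filled b) + 1  ≤⟨ sum-gap a (filled-≤ b) room ⟩
    sum {j} (λ _ → j)   ≡⟨ sum-const j j ⟩
    j * j               ∎
    where
    room : filled b a + 1 ≤ j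
    room = begin
      filled b a + 1    ≡⟨ +-comm (filled b a) 1 ⟩
      suc (filled b a)  ≡⟨ cong suc (trans (filled-off (a≢b ∘ sym)) (D-sym b a)) ⟩
      suc (D a b)       ≤⟨ Dab<j ⟩
      j                 ∎

  -- If the total were j³ - j² - 2, a short row would exist; by parity it is short by 2, and
  -- its short entry makes a second row short, for a total shortfall of at least 3.
  module Tight (tight : j * j + total + 2 ≡ j * (j * j)) where

    rows-short : sum row < sum {j} (λ _ → j * j)
    rows-short = begin-strict
      sum row                 ≡⟨ rows-total ⟩
      j * j + total           <⟨ m<m+n (j * j + total) (s≤s z≤n) ⟩
      j * j + total + 2       ≡⟨ tight ⟩
      j * (j * j)             ≡⟨ sum-const j (j * j) ⟨
      sum {j} (λ _ → j * j)   ∎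

    deficient-row : ∃ λ a → row a + 2 ≤ j * j
    deficient-row =
      let (a , row<jj) = sum-<⇒∃< row (λ _ → j * j) rows-short in a , row-parity-gap a row<jj

    impossible : ⊥
    impossible =
      let (a , room-a)       = deficient-row
          (b , a≢b , Dab<j)  = short-entry a (<-≤-trans (m<m+n (row a) (s≤s z≤n)) room-a)
          three-short : sum row + 3 ≤ sum row + 2
          three-short = begin
            sum row + (2 + 1)       ≤⟨ sum-gap₂ a≢b row-≤ room-a (partner-row a≢b Dab<j) ⟩
            sum {j} (λ _ → j * j)   ≡⟨ sum-const j (j * j) ⟩
            j * (j * j)             ≡⟨ tight ⟨
            j * j + total + 2       ≡⟨ cong (_+ 2) rows-total ⟨
            sum row + 2             ∎
      in contradiction (+-cancelˡ-≤ (sum row) 3 2 three-short) λ { (s≤s (s≤s ())) }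

  not-tight : j * j + total + 2 ≢ j * (j * j)
  not-tight tight = Tight.impossible tight

-- An NL-colouring of C_n with j colours forces 2n ≤ j³ - j² and 2n ≠ j³ - j² - 2.
-- (For n = 0 surjectivity forces j = 0; otherwise apply ColourMatrix to the incidence matrix.)
nl-cycle-bound : ∀ {n j} (c : Fin n → Fin j) → IsNLColoring (Cycle n) j c →
  j * j + (n + n) ≤ j * (j * j) × j * j + (n + n) + 2 ≢ j * (j * j)
nl-cycle-bound {zero} {zero}  c nl = z≤n , λ ()
nl-cycle-bound {zero} {suc j} c nl with IsColoring.surjective (IsNLColoring.coloring nl) zero
... | () , _
nl-cycle-bound {suc m} {j} c nl =
  subst (λ t → j * j + t ≤ j * (j * j)) total≡ total-bound ,
  subst (λ t → j * j + t + 2 ≢ j * (j * j)) total≡ not-tight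
  where
  open Incidence c
  open ArcBound (nl⇒locating nl)
  open ColourMatrix D D-sym D-diag D-≤ (λ a → count a , D-row a)
  total≡ : total ≡ suc m + suc m
  total≡ = begin-equality
    sum (λ a → sum (D a))           ≡⟨ sum-cong-≗ D-row ⟩
    sum (λ a → count a + count a)   ≡⟨ ∑-distrib-+ count count ⟩
    sum count + sum count           ≡⟨ cong₂ _+_ count-total count-total ⟩
    suc m + suc m                   ∎

ℓ-suc : ∀ x h → x * suc x ≡ h + h → ℓ (suc x) ≡ suc x * h
ℓ-suc x h e = begin-equality
  (suc x ^ 3 ∸ suc x ^ 2) / 2                       ≡⟨ cong (λ t → (t ∸ suc x ^ 2) / 2) (cube x) ⟩
  (suc x ^ 2 + suc x * (x * suc x) ∸ suc x ^ 2) / 2  ≡⟨ cong (_/ 2) (m+n∸m≡n (suc x ^ 2) _) ⟩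
  suc x * (x * suc x) / 2                            ≡⟨ cong (λ t → suc x * t / 2) e ⟩
  suc x * (h + h) / 2                                ≡⟨ cong (_/ 2) (double (suc x) h) ⟩
  suc x * h * 2 / 2                                  ≡⟨ m*n/n≡m (suc x * h) 2 ⟩
  suc x * h                                          ∎
  where
  cube : ∀ x → suc x * (suc x * (suc x * 1)) ≡ suc x * (suc x * 1) + suc x * (x * suc x)
  cube = solve-∀
  double : ∀ k h → k * (h + h) ≡ k * h * 2
  double = solve-∀

ℓ-double : ∀ k → k * k + (ℓ k + ℓ k) ≡ k * (k * k)
ℓ-double zero = refl
ℓ-double (suc x) with pronic-even x
... | h , e = begin-equality
  suc x * suc x + (ℓ (suc x) + ℓ (suc x))    ≡⟨ cong (λ t → suc x * suc x + (t + t)) (ℓ-suc x h e) ⟩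
  suc x * suc x + (suc x * h + suc x * h)    ≡⟨ cong (suc x * suc x +_) (*-distribˡ-+ (suc x) h h) ⟨
  suc x * suc x + suc x * (h + h)            ≡⟨ cong (λ t → suc x * suc x + suc x * t) e ⟨
  suc x * suc x + suc x * (x * suc x)        ≡⟨ cube x ⟩
  suc x * (suc x * suc x)                    ∎
  where
  cube : ∀ x → suc x * suc x + suc x * (x * suc x) ≡ suc x * (suc x * suc x)
  cube = solve-∀

-- ℓ(k) ≥ 1 once k ≥ 2, so that (ℓ(k) - 1) + 1 = ℓ(k).
ℓ-positive : ∀ k → 2 ≤ k → 1 ≤ ℓ k
ℓ-positive (suc zero)    (s≤s ())
ℓ-positive (suc (suc y)) _ with pronic-even (suc y)
... | zero  , ()
... | suc h , e = subst (1 ≤_) (sym (ℓ-suc (suc y) (suc h) e)) (s≤s z≤n)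

cycle-order-identity : ∀ k → 2 ≤ k → k * k + ((ℓ k ∸ 1) + (ℓ k ∸ 1)) + 2 ≡ k * (k * k)
cycle-order-identity k 2≤k = begin-equality
  k * k + (n + n) + 2              ≡⟨ regroup (k * k) n ⟩
  k * k + ((n + 1) + (n + 1))      ≡⟨ cong (λ t → k * k + (t + t)) (m∸n+n≡m (ℓ-positive k 2≤k)) ⟩
  k * k + (ℓ k + ℓ k)              ≡⟨ ℓ-double k ⟩
  k * (k * k)                      ∎
  where
  n : ℕ
  n = ℓ k ∸ 1
  regroup : ∀ s n → s + (n + n) + 2 ≡ s + ((n + 1) + (n + 1))
  regroup = solve-∀

-- excess x = x³ - x² = x²(x - 1), the largest possible total of the incidence matrix.
excess : ℕ → ℕ
excess x = x * x * pred x

cube-split : ∀ x → x * (x * x) ≡ x * x + excess x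
cube-split zero    = refl
cube-split (suc y) = expand y
  where
  expand : ∀ y → suc y * (suc y * suc y) ≡ suc y * suc y + suc y * suc y * y
  expand = solve-∀

excess-mono : ∀ {x y} → x ≤ y → excess x ≤ excess y
excess-mono x≤y = *-mono-≤ (*-mono-≤ x≤y x≤y) (pred-mono-≤ x≤y)

excess-jump : ∀ t → excess (suc t) + 2 < excess (suc (suc t))
excess-jump t = subst (excess (suc t) + 2 <_) (sym (expand t)) (m<m+n (excess (suc t) + 2) (s≤s z≤n))
  where
  expand : ∀ t → suc (suc t) * suc (suc t) * suc t ≡ suc t * suc t * t + 2 + suc (3 * (t * t) + 7 * t + 1)
  expand = solve-∀

fewer-colours : ∀ {n j k} → j < k → k * k + (n + n) + 2 ≡ k * (k * k) → ¬ (j * j + (n + n) ≤ j * (j * j))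
fewer-colours {n} {j} {suc K} (s≤s j≤K) identity bound = excess-gap K j≤K twice-n+2
  where
  twice-n≤ : n + n ≤ excess j
  twice-n≤ = +-cancelˡ-≤ (j * j) (n + n) (excess j) (subst (j * j + (n + n) ≤_) (cube-split j) bound)
  twice-n+2 : n + n + 2 ≡ excess (suc K)
  twice-n+2 = +-cancelˡ-≡ (suc K * suc K) (n + n + 2) (excess (suc K))
    (trans (sym (+-assoc (suc K * suc K) (n + n) 2)) (trans identity (cube-split (suc K))))
  excess-gap : ∀ K → j ≤ K → n + n + 2 ≡ excess (suc K) → ⊥
  excess-gap zero    _     e = contradiction (trans (sym (+-comm (n + n) 2)) e) λ ()
  excess-gap (suc t) j≤1+t e = <-irrefl refl (begin-strict
    excess (suc t) + 2       <⟨ excess-jump t ⟩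
    excess (suc (suc t))     ≡⟨ e ⟨
    n + n + 2                ≤⟨ +-monoˡ-≤ 2 (≤-trans twice-n≤ (excess-mono j≤1+t)) ⟩
    excess (suc t) + 2       ∎)

proposition6 : (k : ℕ) → 3 ≤ k → (j : ℕ) → j ≤ k →
    (c : Fin (ℓ k ∸ 1) → Fin j) → ¬ IsNLColoring (Cycle (ℓ k ∸ 1)) j c
proposition6 k 3≤k j j≤k c nl = by-palette-size (m≤n⇒m<n∨m≡n j≤k)
  where
  n : ℕ
  n = ℓ k ∸ 1
  identity : k * k + (n + n) + 2 ≡ k * (k * k)
  identity = cycle-order-identity k (≤-trans (s≤s (s≤s z≤n)) 3≤k)
  bound : j * j + (n + n) ≤ j * (j * j) × j * j + (n + n) + 2 ≢ j * (j * j)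
  bound = nl-cycle-bound c nl
  by-palette-size : j < k ⊎ j ≡ k → ⊥
  by-palette-size (inj₁ j<k) = fewer-colours {n} j<k identity (proj₁ bound)
  by-palette-size (inj₂ j≡k) = proj₂ bound (subst (λ x → x * x + (n + n) + 2 ≡ x * (x * x)) (sym j≡k) identity)
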